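{- A sequent $\Gamma\Rightarrow\theta$ is derivable in the calculus QGP if and only if it is derivable in QGP without any use of the rule (Cut).
   Context: Language: first-order, with predicate symbols and individual constants but no function symbols; logical symbols $\top,\wedge,\vee,\rightarrow,\forall,\exists$; two disjoint infinite sets of variables: free variables $a,b,c,\dots$ (occurring only free) and bound variables $x,y,z,\dots$ (occurring only bound). $\phi[u/x]$ is substitution of $u$ for $x$; $\phi(a)$ denotes $\phi(x)$ with $a$ for $x$. $FreeVar(\Gamma)$ is the set of free variables in $\Gamma$. The calculus QGP (single-conclusion first-order primal logic) works with sequents $\Gamma\Rightarrow\theta$, $\Gamma$ a finite set of formulas and $\theta$ exactly one formula. Axioms: $\phi\Rightarrow\phi$ and $\Rightarrow\top$. Rules: ($\wedge$L) from $\Gamma,\phi,\psi\Rightarrow\theta$ infer $\Gamma,\phi\wedge\psi\Rightarrow\theta$; ($\wedge$R) from $\Gamma\Rightarrow\phi$ and $\Gamma\Rightarrow\psi$ infer $\Gamma\Rightarrow\phi\wedge\psi$; ($\vee$L) from $\Gamma,\phi\Rightarrow\theta$ and $\Gamma,\psi\Rightarrow\theta$ infer $\Gamma,\phi\vee\psi\Rightarrow\theta$; ($\vee$R) from $\Gamma\Rightarrow\phi_i$ infer $\Gamma\Rightarrow\phi_1\vee\phi_2$ ($i=1,2$); ($\rightarrow$L) from $\Gamma,\psi\Rightarrow\theta$ and $\Gamma\Rightarrow\phi$ infer $\Gamma,\phi\rightarrow\psi\Rightarrow\theta$; ($\rightarrow$Rp) from $\Gamma\Rightarrow\psi$ infer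 $\Gamma\Rightarrow\phi\rightarrow\psi$; ($\forall$R) from $\Gamma\Rightarrow\phi(a)$ infer $\Gamma\Rightarrow\forall x\phi(x)$, where $a$ does not occur in the conclusion; ($\forall$L) from $\Gamma,\phi[u/x]\Rightarrow\theta$ infer $\Gamma,\forall x\phi(x)\Rightarrow\theta$, $u$ a constant or free variable; ($\exists$R) from $\Gamma\Rightarrow\phi[u/x]$ infer $\Gamma\Rightarrow\exists x\phi(x)$, $u$ a constant or free variable; ($\exists$L) from $\Gamma,\phi(a)\Rightarrow\theta$ infer $\Gamma,\exists x\phi(x)\Rightarrow\theta$, where $a$ does not occur in the conclusion; (Weakening) from $\Gamma\Rightarrow\theta$ infer $\Gamma,\Gamma_1\Rightarrow\theta$; (Cut) from $\Gamma\Rightarrow\phi$ and $\phi,\Gamma_1\Rightarrow\theta$ infer $\Gamma,\Gamma_1\Rightarrow\theta$. -}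

module Defs where

open import Data.Nat using (ℕ)
open import Data.Nat.Properties using (_≟_)
open import Data.Bool using (Bool; true; false)
open import Data.List using (List; []; _∷_; _++_; concatMap)
open import Data.List.Membership.Propositional using (_∈_; _∉_)
open import Data.List.Relation.Unary.All using (All)
open import Data.Vec using (Vec)
import Data.Vec as Vec
open import Data.Vec.Relation.Unary.All as VAll using ()
open import Relation.Nullary using (yes; no)
open import Function.Bundles using (_⇔_)

record Language : Set₁ where
  field
    Pred  : Set
    arity : Pred → ℕ
    Const : Set

-- Free variables a,b,c,… and bound variables x,y,z,… are two disjoint
-- infinite sorts, both represented by ℕ but kept apart by constructors.
FVar : Set
FVar = ℕ

BVar : Set
BVar = ℕ

module _ (L : Language) where
  open Language L

  data Term : Set where
    const : Const → Term
    fvar  : FVar → Term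
    bvar  : BVar → Term

  data Formula : Set where
    atom    : (P : Pred) → Vec Term (arity P) → Formula
    ⊤′      : Formula
    _∧′_    : Formula → Formula → Formula
    _∨′_    : Formula → Formula → Formula
    _⇒′_    : Formula → Formula → Formula
    ∀′      : BVar → Formula → Formula
    ∃′      : BVar → Formula → Formula

  data Instantiable : Term → Set where
    inst-const : ∀ c → Instantiable (const c)
    inst-fvar  : ∀ a → Instantiable (fvar a)

  substT : BVar → Term → Term → Term
  substT x u (const c) = const c
  substT x u (fvar a)  = fvar a
  substT x u (bvar y) with y ≟ x
  ... | yes _ = u
  ... | no  _ = bvar y

  subst : BVar → Term → Formula → Formula
  subst x u (atom P ts) = atom P (Vec.map (substT x u) ts)
  subst x u ⊤′          = ⊤′
  subst x u (φ ∧′ ψ)    = subst x u φ ∧′ subst x u ψ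
  subst x u (φ ∨′ ψ)    = subst x u φ ∨′ subst x u ψ
  subst x u (φ ⇒′ ψ)    = subst x u φ ⇒′ subst x u ψ
  subst x u (∀′ y φ) with y ≟ x
  ... | yes _ = ∀′ y φ
  ... | no  _ = ∀′ y (subst x u φ)
  subst x u (∃′ y φ) with y ≟ x
  ... | yes _ = ∃′ y φ
  ... | no  _ = ∃′ y (subst x u φ)

  fvT : Term → List FVar
  fvT (const c) = []
  fvT (fvar a)  = a ∷ []
  fvT (bvar x)  = []

  fv : Formula → List FVar
  fv (atom P ts) = concatMap fvT (Vec.toList ts)
  fv ⊤′          = []
  fv (φ ∧′ ψ)    = fv φ ++ fv ψ
  fv (φ ∨′ ψ)    = fv φ ++ fv ψ
  fv (φ ⇒′ ψ)    = fv φ ++ fv ψ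
  fv (∀′ x φ)    = fv φ
  fv (∃′ x φ)    = fv φ

  FreeVar : List Formula → List FVar
  FreeVar Γ = concatMap fv Γ

  -- Well-formedness: bound variables occur only bound.
  -- ClosedIn S φ : every bound variable occurring free in φ is in S.
  data ClosedT (S : List BVar) : Term → Set where
    c-const : ∀ c → ClosedT S (const c)
    c-fvar  : ∀ a → ClosedT S (fvar a)
    c-bvar  : ∀ {x} → x ∈ S → ClosedT S (bvar x)

  data ClosedIn (S : List BVar) : Formula → Set where
    c-atom : ∀ {P ts} → VAll.All (ClosedT S) ts → ClosedIn S (atom P ts)
    c-⊤    : ClosedIn S ⊤′
    c-∧    : ∀ {φ ψ} → ClosedIn S φ → ClosedIn S ψ → ClosedIn S (φ ∧′ ψ)
    c-∨    : ∀ {φ ψ} → ClosedIn S φ → ClosedIn S ψ → ClosedIn S (φ ∨′ ψ)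
    c-⇒    : ∀ {φ ψ} → ClosedIn S φ → ClosedIn S ψ → ClosedIn S (φ ⇒′ ψ)
    c-∀    : ∀ {x φ} → ClosedIn (x ∷ S) φ → ClosedIn S (∀′ x φ)
    c-∃    : ∀ {x φ} → ClosedIn (x ∷ S) φ → ClosedIn S (∃′ x φ)

  IsFormula : Formula → Set
  IsFormula = ClosedIn []

  -- Antecedents are finite sets of formulas, represented by lists;
  -- two lists denote the same set iff they have the same members.
  _≈ₛ_ : List Formula → List Formula → Set
  Γ ≈ₛ Δ = ∀ χ → (χ ∈ Γ) ⇔ (χ ∈ Δ)

  -- The Bool index says whether (Cut) may be used:
  -- QGP ⊢[ true ] is the full calculus, QGP ⊢[ false ] is QGP without Cut.
  -- Γ , φ is rendered as φ ∷ Γ; the rule `set-eq` only expresses that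
  -- antecedents are sets (derivability depends on Γ as a set).
  data QGP_⊢[_]_ : List Formula → Bool → Formula → Set where
    set-eq : ∀ {c Γ Δ θ} → Γ ≈ₛ Δ → QGP Γ ⊢[ c ] θ → QGP Δ ⊢[ c ] θ
    ax     : ∀ {c φ} → QGP (φ ∷ []) ⊢[ c ] φ
    ax-⊤   : ∀ {c} → QGP [] ⊢[ c ] ⊤′
    ∧L     : ∀ {c Γ φ ψ θ} → QGP (φ ∷ ψ ∷ Γ) ⊢[ c ] θ → QGP ((φ ∧′ ψ) ∷ Γ) ⊢[ c ] θ
    ∧R     : ∀ {c Γ φ ψ} → QGP Γ ⊢[ c ] φ → QGP Γ ⊢[ c ] ψ → QGP Γ ⊢[ c ] (φ ∧′ ψ)
    ∨L     : ∀ {c Γ φ ψ θ} → QGP (φ ∷ Γ) ⊢[ c ] θ → QGP (ψ ∷ Γ) ⊢[ c ] θ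
             → QGP ((φ ∨′ ψ) ∷ Γ) ⊢[ c ] θ
    ∨R₁    : ∀ {c Γ φ₁ φ₂} → QGP Γ ⊢[ c ] φ₁ → QGP Γ ⊢[ c ] (φ₁ ∨′ φ₂)
    ∨R₂    : ∀ {c Γ φ₁ φ₂} → QGP Γ ⊢[ c ] φ₂ → QGP Γ ⊢[ c ] (φ₁ ∨′ φ₂)
    ⇒L     : ∀ {c Γ φ ψ θ} → QGP (ψ ∷ Γ) ⊢[ c ] θ → QGP Γ ⊢[ c ] φ
             → QGP ((φ ⇒′ ψ) ∷ Γ) ⊢[ c ] θ
    ⇒Rp    : ∀ {c Γ φ ψ} → QGP Γ ⊢[ c ] ψ → QGP Γ ⊢[ c ] (φ ⇒′ ψ)
    ∀R     : ∀ {c Γ x φ a} → QGP Γ ⊢[ c ] subst x (fvar a) φ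
             → a ∉ FreeVar (∀′ x φ ∷ Γ)
             → QGP Γ ⊢[ c ] ∀′ x φ
    ∀L     : ∀ {c Γ x φ u θ} → Instantiable u
             → QGP (subst x u φ ∷ Γ) ⊢[ c ] θ → QGP (∀′ x φ ∷ Γ) ⊢[ c ] θ
    ∃R     : ∀ {c Γ x φ u} → Instantiable u
             → QGP Γ ⊢[ c ] subst x u φ → QGP Γ ⊢[ c ] ∃′ x φ
    ∃L     : ∀ {c Γ x φ a θ} → QGP (subst x (fvar a) φ ∷ Γ) ⊢[ c ] θ
             → a ∉ FreeVar (θ ∷ ∃′ x φ ∷ Γ)
             → QGP (∃′ x φ ∷ Γ) ⊢[ c ] θ
    weak   : ∀ {c Γ Γ₁ θ} → QGP Γ ⊢[ c ] θ → QGP (Γ ++ Γ₁) ⊢[ c ] θ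
    cut    : ∀ {Γ Γ₁ φ θ} → IsFormula φ
             → QGP Γ ⊢[ true ] φ → QGP (φ ∷ Γ₁) ⊢[ true ] θ
             → QGP (Γ ++ Γ₁) ⊢[ true ] θ

-- Cut is admissible already in a variant G of QGP (written Γ ⊢ θ below) in which
-- a left rule keeps its principal formula in the antecedent (so contraction is
-- built in) and the eigenvariable rules ∀R, ∃L quantify over all but finitely
-- many free variables.  G admits weakening and substitution of constants and
-- free variables for free variables.  A cut on φ is eliminated by induction on
-- the size of φ: it is first permuted upwards in the left premise until φ is
-- introduced by a right rule, and then pushed through the right premise until
-- every use of φ there is principal, where it reduces to cuts on immediate
-- subformulas or instances.  Since primal ⇒R derives φ → ψ from ψ alone, the
-- implication case only needs a cut on ψ.  Finally, QGP derivations (with or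
-- without cut) and G derivations translate into each other, and the translation
-- of G into QGP uses no cut.
module Submission where

open import Defs
open import Data.Bool using (Bool; true; false)
open import Data.Empty using (⊥-elim)
open import Data.List using (List; []; _∷_; _++_; map; concatMap)
open import Data.List.Extrema.Nat using (max; xs≤max)
open import Data.List.Membership.Propositional using (_∈_; _∉_)
open import Data.List.Membership.Propositional.Properties using (∈-map⁺; ∈-++⁺ˡ; ∈-++⁺ʳ; ∈-++⁻)
open import Data.List.Relation.Binary.Subset.Propositional using (_⊆_)
open import Data.List.Relation.Binary.Subset.Propositional.Properties
  using (⊆-refl; xs⊆x∷xs; xs⊆ys++xs; ∷⁺ʳ; ∈-∷⁺ʳ)
open import Data.List.Relation.Unary.All as All using (All)
open import Data.List.Relation.Unary.Any using (here; there)
open import Data.Nat using (ℕ; suc; _+_; _≤_; s≤s)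
open import Data.Nat.Properties using (_≟_; <-irrefl; m+n≤o⇒m≤o; m+n≤o⇒n≤o; ≤-refl)
open import Data.Product using (∃; _,_)
open import Data.Sum using ([_,_]′)
open import Data.Vec using (Vec; []; _∷_)
import Data.Vec as Vec
open import Data.Vec.Properties using (map-∘; map-cong)
open import Function using (id; _∘_)
open import Function.Bundles using (_⇔_; mk⇔; Equivalence)
open import Relation.Nullary using (yes; no)
open import Relation.Binary.PropositionalEquality
  using (_≡_; _≢_; refl; sym; trans; cong; cong₂; module ≡-Reasoning)
import Relation.Binary.PropositionalEquality as ≡

fresh : (xs : List ℕ) → ∃ λ a → a ∉ xs
fresh xs = suc (max 0 xs) , λ p → <-irrefl refl (All.lookup (xs≤max 0 xs) p)

∉-++⁻ˡ : ∀ {a : ℕ} {xs ys} → a ∉ xs ++ ys → a ∉ xs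
∉-++⁻ˡ a∉ = a∉ ∘ ∈-++⁺ˡ

∉-++⁻ʳ : ∀ {a : ℕ} xs {ys} → a ∉ xs ++ ys → a ∉ ys
∉-++⁻ʳ xs a∉ = a∉ ∘ ∈-++⁺ʳ xs

module CutElimination (L : Language) where

  private variable
    c : Bool
    a b : FVar
    x : BVar
    u v : Term L
    φ ψ θ χ : Formula L
    Γ Δ : List (Formula L)

  infix  4 _⊢_ _⊢ʳ_ _⊢[_]_
  infixl 30 _[_/_] _⟦_/_⟧ᵗ _⟦_/_⟧

  _[_/_] : Formula L → Term L → BVar → Formula L
  φ [ u / x ] = subst L x u φ

  _⊢[_]_ : List (Formula L) → Bool → Formula L → Set
  Γ ⊢[ c ] θ = QGP_⊢[_]_ L Γ c θ

  size : Formula L → ℕ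
  size (atom P ts) = 0
  size ⊤′          = 0
  size (φ ∧′ ψ)    = suc (size φ + size ψ)
  size (φ ∨′ ψ)    = suc (size φ + size ψ)
  size (φ ⇒′ ψ)    = suc (size φ + size ψ)
  size (∀′ x φ)    = suc (size φ)
  size (∃′ x φ)    = suc (size φ)

  size-[] : ∀ φ → size (φ [ u / x ]) ≡ size φ
  size-[] (atom P ts) = refl
  size-[] ⊤′          = refl
  size-[] (φ ∧′ ψ)    = cong₂ (λ m k → suc (m + k)) (size-[] φ) (size-[] ψ)
  size-[] (φ ∨′ ψ)    = cong₂ (λ m k → suc (m + k)) (size-[] φ) (size-[] ψ)
  size-[] (φ ⇒′ ψ)    = cong₂ (λ m k → suc (m + k)) (size-[] φ) (size-[] ψ)
  size-[] {x = x} (∀′ y φ) with y ≟ x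
  ... | yes _ = refl
  ... | no  _ = cong suc (size-[] φ)
  size-[] {x = x} (∃′ y φ) with y ≟ x
  ... | yes _ = refl
  ... | no  _ = cong suc (size-[] φ)

  _⟦_/_⟧ᵗ : Term L → Term L → FVar → Term L
  const k ⟦ u / a ⟧ᵗ = const k
  fvar b  ⟦ u / a ⟧ᵗ with b ≟ a
  ... | yes _ = u
  ... | no  _ = fvar b
  bvar y  ⟦ u / a ⟧ᵗ = bvar y

  _⟦_/_⟧ : Formula L → Term L → FVar → Formula L
  atom P ts ⟦ u / a ⟧ = atom P (Vec.map (_⟦ u / a ⟧ᵗ) ts)
  ⊤′        ⟦ u / a ⟧ = ⊤′
  (φ ∧′ ψ)  ⟦ u / a ⟧ = φ ⟦ u / a ⟧ ∧′ ψ ⟦ u / a ⟧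
  (φ ∨′ ψ)  ⟦ u / a ⟧ = φ ⟦ u / a ⟧ ∨′ ψ ⟦ u / a ⟧
  (φ ⇒′ ψ)  ⟦ u / a ⟧ = φ ⟦ u / a ⟧ ⇒′ ψ ⟦ u / a ⟧
  ∀′ x φ    ⟦ u / a ⟧ = ∀′ x (φ ⟦ u / a ⟧)
  ∃′ x φ    ⟦ u / a ⟧ = ∃′ x (φ ⟦ u / a ⟧)

  fvar-⟦⟧ᵗ-self : ∀ a → fvar a ⟦ u / a ⟧ᵗ ≡ u
  fvar-⟦⟧ᵗ-self a with a ≟ a
  ... | yes _   = refl
  ... | no  a≢a = ⊥-elim (a≢a refl)

  fvar-⟦⟧ᵗ-other : b ≢ a → fvar b ⟦ u / a ⟧ᵗ ≡ fvar b
  fvar-⟦⟧ᵗ-other {b} {a} b≢a with b ≟ a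
  ... | yes b≡a = ⊥-elim (b≢a b≡a)
  ... | no  _   = refl

  ⟦⟧ᵗ-instantiable : Instantiable L u → Instantiable L v → Instantiable L (v ⟦ u / a ⟧ᵗ)
  ⟦⟧ᵗ-instantiable iu (inst-const k) = inst-const k
  ⟦⟧ᵗ-instantiable {a = a} iu (inst-fvar b) with b ≟ a
  ... | yes _ = iu
  ... | no  _ = inst-fvar b

  substT-instantiable : Instantiable L u → substT L x v u ≡ u
  substT-instantiable (inst-const k) = refl
  substT-instantiable (inst-fvar b)  = refl

  ⟦⟧ᵗ-substT : Instantiable L u → ∀ t →
               substT L x v t ⟦ u / a ⟧ᵗ ≡ substT L x (v ⟦ u / a ⟧ᵗ) (t ⟦ u / a ⟧ᵗ)
  ⟦⟧ᵗ-substT iu (const k) = refl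
  ⟦⟧ᵗ-substT {a = a} iu (fvar b) with b ≟ a
  ... | yes _ = sym (substT-instantiable iu)
  ... | no  _ = refl
  ⟦⟧ᵗ-substT {x = x} iu (bvar y) with y ≟ x
  ... | yes _ = refl
  ... | no  _ = refl

  ⟦⟧-[] : Instantiable L u → ∀ φ → φ [ v / x ] ⟦ u / a ⟧ ≡ φ ⟦ u / a ⟧ [ v ⟦ u / a ⟧ᵗ / x ]
  ⟦⟧-[] iu (atom P ts) = cong (atom P) (begin
      Vec.map _ (Vec.map _ ts)  ≡⟨ map-∘ _ _ ts ⟨
      Vec.map _ ts              ≡⟨ map-cong (⟦⟧ᵗ-substT iu) ts ⟩
      Vec.map _ ts              ≡⟨ map-∘ _ _ ts ⟩
      Vec.map _ (Vec.map _ ts)  ∎)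
    where open ≡-Reasoning
  ⟦⟧-[] iu ⊤′       = refl
  ⟦⟧-[] iu (φ ∧′ ψ) = cong₂ _∧′_ (⟦⟧-[] iu φ) (⟦⟧-[] iu ψ)
  ⟦⟧-[] iu (φ ∨′ ψ) = cong₂ _∨′_ (⟦⟧-[] iu φ) (⟦⟧-[] iu ψ)
  ⟦⟧-[] iu (φ ⇒′ ψ) = cong₂ _⇒′_ (⟦⟧-[] iu φ) (⟦⟧-[] iu ψ)
  ⟦⟧-[] {x = x} iu (∀′ y φ) with y ≟ x
  ... | yes _ = refl
  ... | no  _ = cong (∀′ y) (⟦⟧-[] iu φ)
  ⟦⟧-[] {x = x} iu (∃′ y φ) with y ≟ x
  ... | yes _ = refl
  ... | no  _ = cong (∃′ y) (⟦⟧-[] iu φ)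

  ⟦⟧ᵗ-fresh : ∀ t → a ∉ fvT L t → t ⟦ u / a ⟧ᵗ ≡ t
  ⟦⟧ᵗ-fresh (const k) a∉ = refl
  ⟦⟧ᵗ-fresh (fvar b)  a∉ = fvar-⟦⟧ᵗ-other (a∉ ∘ here ∘ sym)
  ⟦⟧ᵗ-fresh (bvar y)  a∉ = refl

  ⟦⟧ᵗ-fresh-vec : ∀ {k} (ts : Vec (Term L) k) → a ∉ concatMap (fvT L) (Vec.toList ts) →
                  Vec.map (_⟦ u / a ⟧ᵗ) ts ≡ ts
  ⟦⟧ᵗ-fresh-vec []       a∉ = refl
  ⟦⟧ᵗ-fresh-vec (t ∷ ts) a∉ =
    cong₂ _∷_ (⟦⟧ᵗ-fresh t (∉-++⁻ˡ a∉)) (⟦⟧ᵗ-fresh-vec ts (∉-++⁻ʳ (fvT L t) a∉))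

  ⟦⟧-fresh : ∀ φ → a ∉ fv L φ → φ ⟦ u / a ⟧ ≡ φ
  ⟦⟧-fresh (atom P ts) a∉ = cong (atom P) (⟦⟧ᵗ-fresh-vec ts a∉)
  ⟦⟧-fresh ⊤′          a∉ = refl
  ⟦⟧-fresh (φ ∧′ ψ)    a∉ = cong₂ _∧′_ (⟦⟧-fresh φ (∉-++⁻ˡ a∉)) (⟦⟧-fresh ψ (∉-++⁻ʳ (fv L φ) a∉))
  ⟦⟧-fresh (φ ∨′ ψ)    a∉ = cong₂ _∨′_ (⟦⟧-fresh φ (∉-++⁻ˡ a∉)) (⟦⟧-fresh ψ (∉-++⁻ʳ (fv L φ) a∉))
  ⟦⟧-fresh (φ ⇒′ ψ)    a∉ = cong₂ _⇒′_ (⟦⟧-fresh φ (∉-++⁻ˡ a∉)) (⟦⟧-fresh ψ (∉-++⁻ʳ (fv L φ) a∉))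
  ⟦⟧-fresh (∀′ x φ)    a∉ = cong (∀′ x) (⟦⟧-fresh φ a∉)
  ⟦⟧-fresh (∃′ x φ)    a∉ = cong (∃′ x) (⟦⟧-fresh φ a∉)

  ⟦⟧-fresh-list : ∀ Γ → a ∉ FreeVar L Γ → map (_⟦ u / a ⟧) Γ ≡ Γ
  ⟦⟧-fresh-list []      a∉ = refl
  ⟦⟧-fresh-list (φ ∷ Γ) a∉ =
    cong₂ _∷_ (⟦⟧-fresh φ (∉-++⁻ˡ a∉)) (⟦⟧-fresh-list Γ (∉-++⁻ʳ (fv L φ) a∉))

  ⟦⟧-[fvar-self] : Instantiable L u → ∀ φ → a ∉ fv L φ → φ [ fvar a / x ] ⟦ u / a ⟧ ≡ φ [ u / x ]
  ⟦⟧-[fvar-self] {a = a} {x = x} iu φ a∉ =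
    trans (⟦⟧-[] iu φ) (cong₂ (λ ψ w → ψ [ w / x ]) (⟦⟧-fresh φ a∉) (fvar-⟦⟧ᵗ-self a))

  ⟦⟧-[fvar-other] : Instantiable L u → ∀ φ → b ≢ a →
                    φ [ fvar b / x ] ⟦ u / a ⟧ ≡ φ ⟦ u / a ⟧ [ fvar b / x ]
  ⟦⟧-[fvar-other] {x = x} iu φ b≢a =
    trans (⟦⟧-[] iu φ) (cong (λ w → φ ⟦ _ / _ ⟧ [ w / x ]) (fvar-⟦⟧ᵗ-other b≢a))

  data _⊢_ (Γ : List (Formula L)) : Formula L → Set where
    ax  : φ ∈ Γ → Γ ⊢ φ
    ⊤R  : Γ ⊢ ⊤′
    ∧L  : φ ∧′ ψ ∈ Γ → φ ∷ ψ ∷ Γ ⊢ θ → Γ ⊢ θ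
    ∧R  : Γ ⊢ φ → Γ ⊢ ψ → Γ ⊢ φ ∧′ ψ
    ∨L  : φ ∨′ ψ ∈ Γ → φ ∷ Γ ⊢ θ → ψ ∷ Γ ⊢ θ → Γ ⊢ θ
    ∨R₁ : Γ ⊢ φ → Γ ⊢ φ ∨′ ψ
    ∨R₂ : Γ ⊢ ψ → Γ ⊢ φ ∨′ ψ
    ⇒L  : φ ⇒′ ψ ∈ Γ → ψ ∷ Γ ⊢ θ → Γ ⊢ φ → Γ ⊢ θ
    ⇒Rp : Γ ⊢ ψ → Γ ⊢ φ ⇒′ ψ
    ∀R  : (avoid : List FVar) → (∀ a → a ∉ avoid → Γ ⊢ φ [ fvar a / x ]) → Γ ⊢ ∀′ x φ
    ∀L  : ∀′ x φ ∈ Γ → Instantiable L u → φ [ u / x ] ∷ Γ ⊢ θ → Γ ⊢ θ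
    ∃R  : Instantiable L u → Γ ⊢ φ [ u / x ] → Γ ⊢ ∃′ x φ
    ∃L  : ∃′ x φ ∈ Γ → (avoid : List FVar) →
          (∀ a → a ∉ avoid → φ [ fvar a / x ] ∷ Γ ⊢ θ) → Γ ⊢ θ

  ⊢-mono : Γ ⊆ Δ → Γ ⊢ θ → Δ ⊢ θ
  ⊢-mono Γ⊆Δ (ax p)         = ax (Γ⊆Δ p)
  ⊢-mono Γ⊆Δ ⊤R             = ⊤R
  ⊢-mono Γ⊆Δ (∧L p D)       = ∧L (Γ⊆Δ p) (⊢-mono (∷⁺ʳ _ (∷⁺ʳ _ Γ⊆Δ)) D)
  ⊢-mono Γ⊆Δ (∧R D E)       = ∧R (⊢-mono Γ⊆Δ D) (⊢-mono Γ⊆Δ E)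
  ⊢-mono Γ⊆Δ (∨L p D E)     = ∨L (Γ⊆Δ p) (⊢-mono (∷⁺ʳ _ Γ⊆Δ) D) (⊢-mono (∷⁺ʳ _ Γ⊆Δ) E)
  ⊢-mono Γ⊆Δ (∨R₁ D)        = ∨R₁ (⊢-mono Γ⊆Δ D)
  ⊢-mono Γ⊆Δ (∨R₂ D)        = ∨R₂ (⊢-mono Γ⊆Δ D)
  ⊢-mono Γ⊆Δ (⇒L p D E)     = ⇒L (Γ⊆Δ p) (⊢-mono (∷⁺ʳ _ Γ⊆Δ) D) (⊢-mono Γ⊆Δ E)
  ⊢-mono Γ⊆Δ (⇒Rp D)        = ⇒Rp (⊢-mono Γ⊆Δ D)
  ⊢-mono Γ⊆Δ (∀R avoid D)   = ∀R avoid (λ a a∉ → ⊢-mono Γ⊆Δ (D a a∉))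
  ⊢-mono Γ⊆Δ (∀L p iu D)    = ∀L (Γ⊆Δ p) iu (⊢-mono (∷⁺ʳ _ Γ⊆Δ) D)
  ⊢-mono Γ⊆Δ (∃R iu D)      = ∃R iu (⊢-mono Γ⊆Δ D)
  ⊢-mono Γ⊆Δ (∃L p avoid D) = ∃L (Γ⊆Δ p) avoid (λ a a∉ → ⊢-mono (∷⁺ʳ _ Γ⊆Δ) (D a a∉))

  ⊢-weaken-under : φ ∷ Γ ⊢ θ → φ ∷ χ ∷ Γ ⊢ θ
  ⊢-weaken-under = ⊢-mono (∷⁺ʳ _ (xs⊆x∷xs _ _))

  -- Avoiding a as well keeps the eigenvariables of ∀R and ∃L distinct from a.
  ⊢-⟦⟧ : Instantiable L u → Γ ⊢ θ → map (_⟦ u / a ⟧) Γ ⊢ θ ⟦ u / a ⟧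
  ⊢-⟦⟧ iu (ax p)       = ax (∈-map⁺ _ p)
  ⊢-⟦⟧ iu ⊤R           = ⊤R
  ⊢-⟦⟧ iu (∧L p D)     = ∧L (∈-map⁺ _ p) (⊢-⟦⟧ iu D)
  ⊢-⟦⟧ iu (∧R D E)     = ∧R (⊢-⟦⟧ iu D) (⊢-⟦⟧ iu E)
  ⊢-⟦⟧ iu (∨L p D E)   = ∨L (∈-map⁺ _ p) (⊢-⟦⟧ iu D) (⊢-⟦⟧ iu E)
  ⊢-⟦⟧ iu (∨R₁ D)      = ∨R₁ (⊢-⟦⟧ iu D)
  ⊢-⟦⟧ iu (∨R₂ D)      = ∨R₂ (⊢-⟦⟧ iu D)
  ⊢-⟦⟧ iu (⇒L p D E)   = ⇒L (∈-map⁺ _ p) (⊢-⟦⟧ iu D) (⊢-⟦⟧ iu E)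
  ⊢-⟦⟧ iu (⇒Rp D)      = ⇒Rp (⊢-⟦⟧ iu D)
  ⊢-⟦⟧ {a = a} iu (∀R {φ = φ} avoid D) = ∀R (a ∷ avoid) λ b b∉ →
    ≡.subst (_ ⊢_) (⟦⟧-[fvar-other] iu φ (b∉ ∘ here)) (⊢-⟦⟧ iu (D b (b∉ ∘ there)))
  ⊢-⟦⟧ iu (∀L {φ = φ} p iv D) =
    ∀L (∈-map⁺ _ p) (⟦⟧ᵗ-instantiable iu iv)
       (≡.subst (λ ψ → ψ ∷ _ ⊢ _) (⟦⟧-[] iu φ) (⊢-⟦⟧ iu D))
  ⊢-⟦⟧ iu (∃R {φ = φ} iv D) =
    ∃R (⟦⟧ᵗ-instantiable iu iv) (≡.subst (_ ⊢_) (⟦⟧-[] iu φ) (⊢-⟦⟧ iu D))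
  ⊢-⟦⟧ {a = a} iu (∃L {φ = φ} p avoid D) = ∃L (∈-map⁺ _ p) (a ∷ avoid) λ b b∉ →
    ≡.subst (λ ψ → ψ ∷ _ ⊢ _) (⟦⟧-[fvar-other] iu φ (b∉ ∘ here)) (⊢-⟦⟧ iu (D b (b∉ ∘ there)))

  instantiateʳ : Instantiable L u → a ∉ FreeVar L (∀′ x φ ∷ Γ) →
                 Γ ⊢ φ [ fvar a / x ] → Γ ⊢ φ [ u / x ]
  instantiateʳ {φ = φ} {Γ = Γ} iu a∉ D =
    ≡.subst₂ _⊢_ (⟦⟧-fresh-list Γ (∉-++⁻ʳ (fv L φ) a∉)) (⟦⟧-[fvar-self] iu φ (∉-++⁻ˡ a∉))
                 (⊢-⟦⟧ iu D)

  instantiateˡ : Instantiable L u → a ∉ FreeVar L (θ ∷ ∃′ x φ ∷ Γ) →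
                 φ [ fvar a / x ] ∷ Γ ⊢ θ → φ [ u / x ] ∷ Γ ⊢ θ
  instantiateˡ {a = a} {θ = θ} {x = x} {φ = φ} {Γ = Γ} iu a∉ D =
    ≡.subst₂ _⊢_ (cong₂ _∷_ (⟦⟧-[fvar-self] iu φ (∉-++⁻ˡ φΓ∉))
                            (⟦⟧-fresh-list Γ (∉-++⁻ʳ (fv L φ) φΓ∉)))
                 (⟦⟧-fresh θ (∉-++⁻ˡ a∉)) (⊢-⟦⟧ iu D)
    where
    φΓ∉ : a ∉ FreeVar L (∃′ x φ ∷ Γ)
    φΓ∉ = ∉-++⁻ʳ (fv L θ) a∉

  -- The left premise of a cut once the cut has been permuted up to where φ is introduced.
  data _⊢ʳ_ (Γ : List (Formula L)) : Formula L → Set where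
    ⊤R  : Γ ⊢ʳ ⊤′
    ∧R  : Γ ⊢ φ → Γ ⊢ ψ → Γ ⊢ʳ φ ∧′ ψ
    ∨R₁ : Γ ⊢ φ → Γ ⊢ʳ φ ∨′ ψ
    ∨R₂ : Γ ⊢ ψ → Γ ⊢ʳ φ ∨′ ψ
    ⇒Rp : Γ ⊢ ψ → Γ ⊢ʳ φ ⇒′ ψ
    ∀R  : (avoid : List FVar) → (∀ a → a ∉ avoid → Γ ⊢ φ [ fvar a / x ]) → Γ ⊢ʳ ∀′ x φ
    ∃R  : Instantiable L u → Γ ⊢ φ [ u / x ] → Γ ⊢ʳ ∃′ x φ

  ⊢ʳ-mono : Γ ⊆ Δ → Γ ⊢ʳ φ → Δ ⊢ʳ φ
  ⊢ʳ-mono Γ⊆Δ ⊤R           = ⊤R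
  ⊢ʳ-mono Γ⊆Δ (∧R D E)     = ∧R (⊢-mono Γ⊆Δ D) (⊢-mono Γ⊆Δ E)
  ⊢ʳ-mono Γ⊆Δ (∨R₁ D)      = ∨R₁ (⊢-mono Γ⊆Δ D)
  ⊢ʳ-mono Γ⊆Δ (∨R₂ D)      = ∨R₂ (⊢-mono Γ⊆Δ D)
  ⊢ʳ-mono Γ⊆Δ (⇒Rp D)      = ⇒Rp (⊢-mono Γ⊆Δ D)
  ⊢ʳ-mono Γ⊆Δ (∀R avoid D) = ∀R avoid (λ a a∉ → ⊢-mono Γ⊆Δ (D a a∉))
  ⊢ʳ-mono Γ⊆Δ (∃R iu D)    = ∃R iu (⊢-mono Γ⊆Δ D)

  ⊢ʳ⇒⊢ : Γ ⊢ʳ φ → Γ ⊢ φ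
  ⊢ʳ⇒⊢ ⊤R           = ⊤R
  ⊢ʳ⇒⊢ (∧R D E)     = ∧R D E
  ⊢ʳ⇒⊢ (∨R₁ D)      = ∨R₁ D
  ⊢ʳ⇒⊢ (∨R₂ D)      = ∨R₂ D
  ⊢ʳ⇒⊢ (⇒Rp D)      = ⇒Rp D
  ⊢ʳ⇒⊢ (∀R avoid D) = ∀R avoid D
  ⊢ʳ⇒⊢ (∃R iu D)    = ∃R iu D

  ⊆-∷-under : Δ ⊆ φ ∷ Γ → χ ∷ Δ ⊆ φ ∷ χ ∷ Γ
  ⊆-∷-under Δ⊆φΓ (here refl) = there (here refl)
  ⊆-∷-under Δ⊆φΓ (there p) with Δ⊆φΓ p
  ... | here refl = here refl
  ... | there q   = there (there q)

  mutual
    cut-admissible : ∀ n → size φ ≤ n → Γ ⊢ φ → φ ∷ Γ ⊢ θ → Γ ⊢ θ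
    cut-admissible n sz (ax p)         E = ⊢-mono (∈-∷⁺ʳ p ⊆-refl) E
    cut-admissible n sz ⊤R             E = cut-⊢ʳ n sz ⊤R ⊆-refl E
    cut-admissible n sz (∧R D D′)      E = cut-⊢ʳ n sz (∧R D D′) ⊆-refl E
    cut-admissible n sz (∨R₁ D)        E = cut-⊢ʳ n sz (∨R₁ D) ⊆-refl E
    cut-admissible n sz (∨R₂ D)        E = cut-⊢ʳ n sz (∨R₂ D) ⊆-refl E
    cut-admissible n sz (⇒Rp D)        E = cut-⊢ʳ n sz (⇒Rp D) ⊆-refl E
    cut-admissible n sz (∀R avoid D)   E = cut-⊢ʳ n sz (∀R avoid D) ⊆-refl E
    cut-admissible n sz (∃R iu D)      E = cut-⊢ʳ n sz (∃R iu D) ⊆-refl E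
    cut-admissible n sz (∧L p D)       E =
      ∧L p (cut-admissible n sz D (⊢-weaken-under (⊢-weaken-under E)))
    cut-admissible n sz (∨L p D D′)    E =
      ∨L p (cut-admissible n sz D (⊢-weaken-under E)) (cut-admissible n sz D′ (⊢-weaken-under E))
    cut-admissible n sz (⇒L p D D′)    E = ⇒L p (cut-admissible n sz D (⊢-weaken-under E)) D′
    cut-admissible n sz (∀L p iu D)    E = ∀L p iu (cut-admissible n sz D (⊢-weaken-under E))
    cut-admissible n sz (∃L p avoid D) E =
      ∃L p avoid (λ a a∉ → cut-admissible n sz (D a a∉) (⊢-weaken-under E))

    cut-⊢ʳ : ∀ n → size φ ≤ n → Γ ⊢ʳ φ → Δ ⊆ φ ∷ Γ → Δ ⊢ θ → Γ ⊢ θ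
    cut-⊢ʳ n sz R Δ⊆ (ax p) with Δ⊆ p
    ... | here refl = ⊢ʳ⇒⊢ R
    ... | there q   = ax q
    cut-⊢ʳ n sz R Δ⊆ ⊤R           = ⊤R
    cut-⊢ʳ n sz R Δ⊆ (∧R E E′)    = ∧R (cut-⊢ʳ n sz R Δ⊆ E) (cut-⊢ʳ n sz R Δ⊆ E′)
    cut-⊢ʳ n sz R Δ⊆ (∨R₁ E)      = ∨R₁ (cut-⊢ʳ n sz R Δ⊆ E)
    cut-⊢ʳ n sz R Δ⊆ (∨R₂ E)      = ∨R₂ (cut-⊢ʳ n sz R Δ⊆ E)
    cut-⊢ʳ n sz R Δ⊆ (⇒Rp E)      = ⇒Rp (cut-⊢ʳ n sz R Δ⊆ E)
    cut-⊢ʳ n sz R Δ⊆ (∀R avoid E) = ∀R avoid (λ a a∉ → cut-⊢ʳ n sz R Δ⊆ (E a a∉))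
    cut-⊢ʳ n sz R Δ⊆ (∃R iu E)    = ∃R iu (cut-⊢ʳ n sz R Δ⊆ E)
    cut-⊢ʳ n sz R Δ⊆ (∧L p E) with Δ⊆ p
    ... | here refl = cut-∧ n sz R (cut-⊢ʳ-under² n sz R Δ⊆ E)
    ... | there q   = ∧L q (cut-⊢ʳ-under² n sz R Δ⊆ E)
    cut-⊢ʳ n sz R Δ⊆ (∨L p E E′) with Δ⊆ p
    ... | here refl = cut-∨ n sz R (cut-⊢ʳ-under n sz R Δ⊆ E) (cut-⊢ʳ-under n sz R Δ⊆ E′)
    ... | there q   = ∨L q (cut-⊢ʳ-under n sz R Δ⊆ E) (cut-⊢ʳ-under n sz R Δ⊆ E′)
    cut-⊢ʳ n sz R Δ⊆ (⇒L p E E′) with Δ⊆ p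
    ... | here refl = cut-⇒ n sz R (cut-⊢ʳ-under n sz R Δ⊆ E)
    ... | there q   = ⇒L q (cut-⊢ʳ-under n sz R Δ⊆ E) (cut-⊢ʳ n sz R Δ⊆ E′)
    cut-⊢ʳ n sz R Δ⊆ (∀L p iu E) with Δ⊆ p
    ... | here refl = cut-∀ n sz R iu (cut-⊢ʳ-under n sz R Δ⊆ E)
    ... | there q   = ∀L q iu (cut-⊢ʳ-under n sz R Δ⊆ E)
    cut-⊢ʳ n sz R Δ⊆ (∃L p avoid E) with Δ⊆ p
    ... | here refl = cut-∃ n sz R avoid (λ a a∉ → cut-⊢ʳ-under n sz R Δ⊆ (E a a∉))
    ... | there q   = ∃L q avoid (λ a a∉ → cut-⊢ʳ-under n sz R Δ⊆ (E a a∉))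

    cut-⊢ʳ-under : ∀ n → size φ ≤ n → Γ ⊢ʳ φ → Δ ⊆ φ ∷ Γ → χ ∷ Δ ⊢ θ → χ ∷ Γ ⊢ θ
    cut-⊢ʳ-under n sz R Δ⊆ = cut-⊢ʳ n sz (⊢ʳ-mono (xs⊆x∷xs _ _) R) (⊆-∷-under Δ⊆)

    cut-⊢ʳ-under² : ∀ n → size φ ≤ n → Γ ⊢ʳ φ → Δ ⊆ φ ∷ Γ → χ ∷ ψ ∷ Δ ⊢ θ → χ ∷ ψ ∷ Γ ⊢ θ
    cut-⊢ʳ-under² n sz R Δ⊆ = cut-⊢ʳ-under n sz (⊢ʳ-mono (xs⊆x∷xs _ _) R) (⊆-∷-under Δ⊆)

    cut-∧ : ∀ n → size (φ ∧′ ψ) ≤ n → Γ ⊢ʳ φ ∧′ ψ → φ ∷ ψ ∷ Γ ⊢ θ → Γ ⊢ θ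
    cut-∧ {φ = φ} (suc n) (s≤s sz) (∧R D D′) E =
      cut-admissible n (m+n≤o⇒n≤o (size φ) sz) D′
        (cut-admissible n (m+n≤o⇒m≤o (size φ) sz) (⊢-mono (xs⊆x∷xs _ _) D) E)

    cut-∨ : ∀ n → size (φ ∨′ ψ) ≤ n → Γ ⊢ʳ φ ∨′ ψ → φ ∷ Γ ⊢ θ → ψ ∷ Γ ⊢ θ → Γ ⊢ θ
    cut-∨ {φ = φ} (suc n) (s≤s sz) (∨R₁ D) E E′ = cut-admissible n (m+n≤o⇒m≤o (size φ) sz) D E
    cut-∨ {φ = φ} (suc n) (s≤s sz) (∨R₂ D) E E′ = cut-admissible n (m+n≤o⇒n≤o (size φ) sz) D E′

    cut-⇒ : ∀ n → size (φ ⇒′ ψ) ≤ n → Γ ⊢ʳ φ ⇒′ ψ → ψ ∷ Γ ⊢ θ → Γ ⊢ θ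
    cut-⇒ {φ = φ} (suc n) (s≤s sz) (⇒Rp D) E = cut-admissible n (m+n≤o⇒n≤o (size φ) sz) D E

    cut-∀ : ∀ n → size (∀′ x φ) ≤ n → Γ ⊢ʳ ∀′ x φ → Instantiable L u → φ [ u / x ] ∷ Γ ⊢ θ → Γ ⊢ θ
    cut-∀ {x = x} {φ = φ} {Γ = Γ} (suc n) (s≤s sz) (∀R avoid D) iu E
      with fresh (avoid ++ FreeVar L (∀′ x φ ∷ Γ))
    ... | a , a∉ = cut-admissible n (≡.subst (_≤ n) (sym (size-[] φ)) sz)
                     (instantiateʳ {x = x} {φ = φ} iu (∉-++⁻ʳ avoid a∉) (D a (∉-++⁻ˡ a∉))) E

    cut-∃ : ∀ n → size (∃′ x φ) ≤ n → Γ ⊢ʳ ∃′ x φ → (avoid : List FVar) →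
            (∀ a → a ∉ avoid → φ [ fvar a / x ] ∷ Γ ⊢ θ) → Γ ⊢ θ
    cut-∃ {x = x} {φ = φ} {Γ = Γ} {θ = θ} (suc n) (s≤s sz) (∃R iu D) avoid E
      with fresh (avoid ++ FreeVar L (θ ∷ ∃′ x φ ∷ Γ))
    ... | a , a∉ = cut-admissible n (≡.subst (_≤ n) (sym (size-[] φ)) sz) D
                     (instantiateˡ {x = x} {φ = φ} iu (∉-++⁻ʳ avoid a∉) (E a (∉-++⁻ˡ a∉)))

  QGP⇒⊢ : Γ ⊢[ c ] θ → Γ ⊢ θ
  QGP⇒⊢ (set-eq Γ≈Δ D) = ⊢-mono (λ {χ} → Equivalence.to (Γ≈Δ χ)) (QGP⇒⊢ D)
  QGP⇒⊢ ax              = ax (here refl)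
  QGP⇒⊢ ax-⊤            = ⊤R
  QGP⇒⊢ (∧L D)          = ∧L (here refl) (⊢-mono (∷⁺ʳ _ (∷⁺ʳ _ (xs⊆x∷xs _ _))) (QGP⇒⊢ D))
  QGP⇒⊢ (∧R D E)        = ∧R (QGP⇒⊢ D) (QGP⇒⊢ E)
  QGP⇒⊢ (∨L D E)        = ∨L (here refl) (⊢-weaken-under (QGP⇒⊢ D)) (⊢-weaken-under (QGP⇒⊢ E))
  QGP⇒⊢ (∨R₁ D)         = ∨R₁ (QGP⇒⊢ D)
  QGP⇒⊢ (∨R₂ D)         = ∨R₂ (QGP⇒⊢ D)
  QGP⇒⊢ (⇒L D E)        =
    ⇒L (here refl) (⊢-weaken-under (QGP⇒⊢ D)) (⊢-mono (xs⊆x∷xs _ _) (QGP⇒⊢ E))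
  QGP⇒⊢ (⇒Rp D)         = ⇒Rp (QGP⇒⊢ D)
  QGP⇒⊢ (∀R {x = x} {φ = φ} D a∉) =
    ∀R [] (λ b _ → instantiateʳ {x = x} {φ = φ} (inst-fvar b) a∉ (QGP⇒⊢ D))
  QGP⇒⊢ (∀L iu D)       = ∀L (here refl) iu (⊢-weaken-under (QGP⇒⊢ D))
  QGP⇒⊢ (∃R iu D)       = ∃R iu (QGP⇒⊢ D)
  QGP⇒⊢ (∃L {x = x} {φ = φ} D a∉) =
    ∃L (here refl) [] (λ b _ →
      ⊢-weaken-under (instantiateˡ {x = x} {φ = φ} (inst-fvar b) a∉ (QGP⇒⊢ D)))
  QGP⇒⊢ (weak D)        = ⊢-mono ∈-++⁺ˡ (QGP⇒⊢ D)
  QGP⇒⊢ (cut {Γ = Γ} {φ = φ} _ D E) =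
    cut-admissible (size φ) ≤-refl (⊢-mono ∈-++⁺ˡ (QGP⇒⊢ D))
                                   (⊢-mono (∷⁺ʳ _ (xs⊆ys++xs _ Γ)) (QGP⇒⊢ E))

  QGP-mono : Γ ⊆ Δ → Γ ⊢[ c ] θ → Δ ⊢[ c ] θ
  QGP-mono {Γ = Γ} Γ⊆Δ D = set-eq (λ χ → mk⇔ ([ Γ⊆Δ , id ]′ ∘ ∈-++⁻ Γ) (xs⊆ys++xs _ Γ)) (weak D)

  ⊢⇒QGP : Γ ⊢ θ → Γ ⊢[ c ] θ
  ⊢⇒QGP (ax p)         = QGP-mono (∈-∷⁺ʳ p (λ ())) ax
  ⊢⇒QGP ⊤R             = QGP-mono (λ ()) ax-⊤
  ⊢⇒QGP (∧L p D)       = QGP-mono (∈-∷⁺ʳ p ⊆-refl) (∧L (⊢⇒QGP D))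
  ⊢⇒QGP (∧R D E)       = ∧R (⊢⇒QGP D) (⊢⇒QGP E)
  ⊢⇒QGP (∨L p D E)     = QGP-mono (∈-∷⁺ʳ p ⊆-refl) (∨L (⊢⇒QGP D) (⊢⇒QGP E))
  ⊢⇒QGP (∨R₁ D)        = ∨R₁ (⊢⇒QGP D)
  ⊢⇒QGP (∨R₂ D)        = ∨R₂ (⊢⇒QGP D)
  ⊢⇒QGP (⇒L p D E)     = QGP-mono (∈-∷⁺ʳ p ⊆-refl) (⇒L (⊢⇒QGP D) (⊢⇒QGP E))
  ⊢⇒QGP (⇒Rp D)        = ⇒Rp (⊢⇒QGP D)
  ⊢⇒QGP {Γ = Γ} (∀R {φ = φ} {x = x} avoid D) with fresh (avoid ++ FreeVar L (∀′ x φ ∷ Γ))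
  ... | a , a∉ = ∀R (⊢⇒QGP (D a (∉-++⁻ˡ a∉))) (∉-++⁻ʳ avoid a∉)
  ⊢⇒QGP (∀L p iu D)    = QGP-mono (∈-∷⁺ʳ p ⊆-refl) (∀L iu (⊢⇒QGP D))
  ⊢⇒QGP (∃R iu D)      = ∃R iu (⊢⇒QGP D)
  ⊢⇒QGP {Γ = Γ} {θ = θ} (∃L {x = x} {φ = φ} p avoid D)
    with fresh (avoid ++ FreeVar L (θ ∷ ∃′ x φ ∷ Γ))
  ... | a , a∉ = QGP-mono (∈-∷⁺ʳ p ⊆-refl) (∃L (⊢⇒QGP (D a (∉-++⁻ˡ a∉))) (∉-++⁻ʳ avoid a∉))

theorem2 : (L : Language) (Γ : List (Formula L)) (θ : Formula L)
    → All (IsFormula L) Γ → IsFormula L θ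
    → (QGP_⊢[_]_ L Γ true θ) ⇔ (QGP_⊢[_]_ L Γ false θ)
theorem2 L Γ θ _ _ = mk⇔ (⊢⇒QGP ∘ QGP⇒⊢) (⊢⇒QGP ∘ QGP⇒⊢)
  where open CutElimination L
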